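{- $\sigma^{ - }(P(3,1)) = 3$.
   Context: The generalized Petersen graph $P(3,1)$ has vertex set $\{u_i, v_i : i=0,1,2\}$ and edge set $\{u_iu_{i+1},\ u_iv_i,\ v_iv_{i+1} : i=0,1,2\}$, subscripts read modulo $3$. For a simple connected graph $G$ of order $N$, the \textbf{rna} number $\sigma^{ - }(G)$ is the minimum, over all bijections $f: V(G)\to\{1,2,\dots,N\}$, of the number of edges $uv$ of $G$ such that $f(u)$ and $f(v)$ have different parity. -}

module Defs where

open import Data.Nat using (ℕ; zero; suc; _+_; _≤_; _%_)
open import Data.Fin using (Fin; toℕ; #_)
open import Data.Product using (_×_; _,_; ∃; Σ)
open import Data.List using (List; []; _∷_; length; filter)
open import Data.Bool using (Bool; true; false; not; _xor_)
open import Relation.Nullary using (Dec; yes; no)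
open import Data.Bool.Properties using (_≟_)
open import Function.Bundles using (Bijection; _⤖_)
open import Relation.Binary.PropositionalEquality using (_≡_)

-- A simple graph on vertex set Fin n, given by its list of edges
-- (each unordered edge listed exactly once as a pair).
record Graph : Set where
  field
    order : ℕ
    edges : List (Fin order × Fin order)
open Graph public

-- Generalized Petersen graph P(3,1).
-- Vertex encoding: u_i = i, v_i = 3 + i  (i = 0,1,2).
P31 : Graph
P31 = record
  { order = 6
  ; edges =
      (# 0 , # 1) ∷ (# 1 , # 2) ∷ (# 2 , # 0) ∷
      (# 0 , # 3) ∷ (# 1 , # 4) ∷ (# 2 , # 5) ∷
      (# 3 , # 4) ∷ (# 4 , # 5) ∷ (# 5 , # 3) ∷ []
  }

-- A labeling is a bijection V(G) → {1,…,N}; label set {1,…,N} is encoded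
-- as Fin N, where k : Fin N stands for the label toℕ k + 1.
Labeling : Graph → Set
Labeling G = Fin (order G) ⤖ Fin (order G)

label : (G : Graph) → Labeling G → Fin (order G) → ℕ
label G f x = suc (toℕ (Bijection.to f x))

isOdd : ℕ → Bool
isOdd zero = false
isOdd (suc n) = not (isOdd n)

mixed : (G : Graph) → Labeling G → Fin (order G) × Fin (order G) → Bool
mixed G f (u , v) = isOdd (label G f u) xor isOdd (label G f v)

mixedCount : (G : Graph) → Labeling G → ℕ
mixedCount G f = length (filter (λ e → mixed G f e ≟ true) (edges G))

IsRnaNumber : Graph → ℕ → Set
IsRnaNumber G k =
  (Σ (Labeling G) λ f → mixedCount G f ≡ k) ×
  ((f : Labeling G) → k ≤ mixedCount G f)

-- A labeling is mixed exactly on the edges crossing the cut between its odd- and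
-- even-labelled vertices. Labels 1 and 2 both occur, so that cut is proper, and
-- P(3,1) is 3-edge-connected (checked over all 2-colourings of its vertices),
-- hence at least three edges are mixed. Labelling the outer triangle odd and the
-- inner triangle even leaves only the three spokes mixed.
module Submission where

open import Defs
open import Data.Nat using (ℕ; suc; _+_; _≤_; _≤?_)
open import Data.Fin using (Fin; toℕ; #_)
open import Data.Fin.Properties using (any?; *↔×)
open import Data.Fin.Subset.Properties using (anySubset?)
open import Data.Product using (_×_; _,_; ∃)
open import Data.Product.Algebra using (×-comm)
open import Data.List using (length; filter)
open import Data.List.Properties using (filter-≐)
open import Data.Vec using (Vec; lookup; tabulate)
open import Data.Vec.Properties using (lookup∘tabulate)
open import Data.Bool using (Bool; true; false; _xor_)
open import Data.Bool.Properties using (_≟_)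
open import Function using (_∘_)
open import Function.Bundles using (Bijection; _⤖_)
open import Function.Construct.Composition using (_↔-∘_)
open import Function.Properties.Inverse using (↔-sym; ↔⇒⤖)
open import Relation.Nullary using (Dec; ¬?; map′)
open import Relation.Nullary.Decidable using (_×-dec_; _→-dec_; decidable-stable; from-yes)
open import Relation.Unary using (Decidable)
open import Relation.Binary.PropositionalEquality using (_≡_; _≗_; refl; sym; trans; cong; cong₂; subst)

crosses : ∀ {n} → (Fin n → Bool) → Fin n × Fin n → Bool
crosses c (u , v) = c u xor c v

cutSize : (G : Graph) → (Fin (order G) → Bool) → ℕ
cutSize G c = length (filter (λ e → crosses c e ≟ true) (edges G))

oddLabelled : (G : Graph) → Labeling G → Fin (order G) → Bool
oddLabelled G f x = isOdd (label G f x)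

mixedCount≡cutSize-oddLabelled : ∀ G f → mixedCount G f ≡ cutSize G (oddLabelled G f)
mixedCount≡cutSize-oddLabelled G f = refl

cutSize-cong : ∀ G {c d} → c ≗ d → cutSize G c ≡ cutSize G d
cutSize-cong G {c} {d} c≗d =
  cong length (filter-≐ (λ e → crosses c e ≟ true) (λ e → crosses d e ≟ true)
                        ((λ {e} → trans (sym (same e))) , (λ {e} → trans (same e)))
                        (edges G))
  where
  same : ∀ e → crosses c e ≡ crosses d e
  same (u , v) = cong₂ _xor_ (c≗d u) (c≗d v)

Bichromatic : ∀ {n} → (Fin n → Bool) → Set
Bichromatic c = (∃ λ x → c x ≡ true) × (∃ λ x → c x ≡ false)

Bichromatic-resp : ∀ {n} {c d : Fin n → Bool} → c ≗ d → Bichromatic c → Bichromatic d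
Bichromatic-resp c≗d ((x , cx) , (y , cy)) = (x , trans (sym (c≗d x)) cx) , (y , trans (sym (c≗d y)) cy)

bichromatic? : ∀ {n} (c : Fin n → Bool) → Dec (Bichromatic c)
bichromatic? c = any? (λ x → c x ≟ true) ×-dec any? (λ x → c x ≟ false)

oddLabelled-bichromatic : ∀ {n} (f : Fin (2 + n) ⤖ Fin (2 + n)) →
                          Bichromatic (λ x → isOdd (suc (toℕ (Bijection.to f x))))
oddLabelled-bichromatic f = labelled (# 0) , labelled (# 1)
  where
  labelled : ∀ y → ∃ λ x → isOdd (suc (toℕ (Bijection.to f x))) ≡ isOdd (suc (toℕ y))
  labelled y with Bijection.strictlySurjective f y
  ... | x , fx≡y = x , cong (isOdd ∘ suc ∘ toℕ) fx≡y

allBoolVecs? : ∀ {n} {P : Vec Bool n → Set} → Decidable P → Dec (∀ v → P v)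
allBoolVecs? P? =
  map′ (λ noCounterexample v → decidable-stable (P? v) (λ ¬Pv → noCounterexample (v , ¬Pv)))
       (λ ∀P (v , ¬Pv) → ¬Pv (∀P v))
       (¬? (anySubset? (¬? ∘ P?)))

P31-bichromatic⇒3≤cutSize : (c : Fin 6 → Bool) → Bichromatic c → 3 ≤ cutSize P31 c
P31-bichromatic⇒3≤cutSize c bichromatic =
  subst (3 ≤_) (cutSize-cong P31 (lookup∘tabulate c))
    (allCuts (tabulate c) (Bichromatic-resp (sym ∘ lookup∘tabulate c) bichromatic))
  where
  allCuts : ∀ v → Bichromatic (lookup v) → 3 ≤ cutSize P31 (lookup v)
  allCuts = from-yes (allBoolVecs? λ v → bichromatic? (lookup v) →-dec (3 ≤? cutSize P31 (lookup v)))

-- Vertex 3s + i (side s, position i) gets label 2i + s + 1.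
outerOddInnerEven : Labeling P31
outerOddInnerEven = ↔⇒⤖ (↔-sym (*↔× {3} {2}) ↔-∘ (×-comm (Fin 2) (Fin 3) ↔-∘ *↔× {2} {3}))

lemma4p6 : IsRnaNumber P31 3
lemma4p6 = (outerOddInnerEven , refl) , atLeastThree
  where
  atLeastThree : (f : Labeling P31) → 3 ≤ mixedCount P31 f
  atLeastThree f = subst (3 ≤_) (sym (mixedCount≡cutSize-oddLabelled P31 f))
    (P31-bichromatic⇒3≤cutSize (oddLabelled P31 f) (oddLabelled-bichromatic f))
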